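{- Let $I=\langle\mathcal{A}^+\cdot\mathcal{A}^+\rangle$ be the tridendriform ideal of $\mathcal{A}^+$ generated by $\{x\cdot y:x,y\in\mathcal{A}^+\}$. A reduced tree $t$ is not a binary tree (i.e. some internal vertex of $t$ has at least three children) if and only if $t\in I$.
   Context: A reduced tree is a planar rooted tree whose internal vertices have at least two children; $|$ is the one-leaf tree; $T_n$ = reduced trees with $n+1$ leaves; $\mathcal{A}=\bigoplus_{n\ge0}\mathbb{K}T_n$, $\mathcal{A}^+=\bigoplus_{n\ge1}\mathbb{K}T_n$. With $x^{(0)}\vee\cdots\vee x^{(k)}$ ($k\ge1$) the grafting of trees left to right on a new root (multilinear), recursively $x\prec y=x^{(0)}\vee\cdots\vee x^{(k-1)}\vee(x^{(k)}*y)$, $x\cdot y=x^{(0)}\vee\cdots\vee x^{(k-1)}\vee(x^{(k)}*y^{(0)})\vee y^{(1)}\vee\cdots\vee y^{(l)}$, $x\succ y=(x*y^{(0)})\vee y^{(1)}\vee\cdots\vee y^{(l)}$ for $x=x^{(0)}\vee\cdots\vee x^{(k)}$, $y=y^{(0)}\vee\cdots\vee y^{(l)}$, where $*=\prec+\cdot+\succ$ and $|$ is a unit for $*$. A tridendriform ideal is a subspace $I$ with $x\ltimes y\in I$ for all $\ltimes\in\{\prec,\cdot,\succ\}$ whenever $x\in I$ or $y\in I$. A binary tree is a reduced tree all of whose internal vertices have exactly two children (the tree $|$ counts as binary). -}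

module Defs where

open import Level using (Level; _⊔_; suc)
open import Algebra.Bundles using (CommutativeRing)
open import Data.Bool using (Bool; true; false; _∧_; if_then_else_)
open import Data.List using (List; []; _∷_; _++_; map; concatMap)
open import Data.Product using (_×_; _,_; Σ; ∃)
open import Relation.Nullary using (¬_)

record Field (c ℓ : Level) : Set (suc (c ⊔ ℓ)) where
  field
    commutativeRing : CommutativeRing c ℓ
  open CommutativeRing commutativeRing public
  field
    0≉1     : ¬ (0# ≈ 1#)
    inverse : ∀ x → ¬ (x ≈ 0#) → ∃ λ y → x * y ≈ 1#

-- Reduced planar rooted trees: either the one-leaf tree |, or a root
-- with an ordered list of at least two children  (node c₀ c₁ [c₂,…,cₖ]).

data Tree : Set where
  leaf : Tree
  node : Tree → Tree → List Tree → Tree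

data IsBinary : Tree → Set where
  leaf : IsBinary leaf
  node : ∀ {a b} → IsBinary a → IsBinary b → IsBinary (node a b [])

mutual
  eqT : Tree → Tree → Bool
  eqT leaf leaf = true
  eqT leaf (node _ _ _) = false
  eqT (node _ _ _) leaf = false
  eqT (node a b cs) (node a′ b′ cs′) = eqT a a′ ∧ (eqT b b′ ∧ eqL cs cs′)

  eqL : List Tree → List Tree → Bool
  eqL [] [] = true
  eqL [] (_ ∷ _) = false
  eqL (_ ∷ _) [] = false
  eqL (t ∷ ts) (t′ ∷ ts′) = eqT t t′ ∧ eqL ts ts′

module TriDend {c ℓ} (F : Field c ℓ) where
  open Field F

  LC : Set → Set c
  LC A = List (Carrier × A)

  mapLC : {A B : Set} → (A → B) → LC A → LC B
  mapLC f = map (λ { (k , a) → (k , f a) })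

  𝒜 : Set c
  𝒜 = LC Tree

  basis : Tree → 𝒜
  basis t = (1# , t) ∷ []

  _⊙_ : Carrier → 𝒜 → 𝒜
  k ⊙ v = map (λ { (k′ , t) → (k * k′ , t) }) v

  coeff : 𝒜 → Tree → Carrier
  coeff [] s = 0#
  coeff ((k , t) ∷ v) s = (if eqT t s then k else 0#) + coeff v s

  _≈𝒜_ : 𝒜 → 𝒜 → Set ℓ
  u ≈𝒜 v = ∀ s → coeff u s ≈ coeff v s

  -- membership in 𝒜⁺ = ⊕_{n≥1} 𝕂Tₙ : no component on the tree |
  In𝒜⁺ : 𝒜 → Set ℓ
  In𝒜⁺ v = coeff v leaf ≈ 0#

  -- The operations on basis trees.  | is the unit for *; the three
  -- operations ≺ , · , ≻ are only applied to trees different from |.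
  -- lastStar c cs y : the child sequence c ∷ cs (nonempty) with its last
  -- entry x⁽ᵏ⁾ replaced by x⁽ᵏ⁾ * y  (multilinearly), as (head , tail).
  mutual
    star : Tree → Tree → 𝒜
    star leaf y = basis y
    star (node a b cs) leaf = basis (node a b cs)
    star (node a b cs) (node d e fs) =
      prec a b cs (node d e fs) ++ (dot a b cs d e fs ++ succ (node a b cs) d e fs)

    lastStar : Tree → List Tree → Tree → LC (Tree × List Tree)
    lastStar c [] y = mapLC (λ t → (t , [])) (star c y)
    lastStar c (d ∷ ds) y = mapLC (λ { (h , t) → (c , h ∷ t) }) (lastStar d ds y)

    -- x ≺ y = x⁽⁰⁾ ∨ ⋯ ∨ x⁽ᵏ⁻¹⁾ ∨ (x⁽ᵏ⁾ * y),  x = node a b cs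
    prec : Tree → Tree → List Tree → Tree → 𝒜
    prec a b cs y = mapLC (λ { (h , t) → node a h t }) (lastStar b cs y)

    -- x · y = x⁽⁰⁾ ∨ ⋯ ∨ x⁽ᵏ⁻¹⁾ ∨ (x⁽ᵏ⁾ * y⁽⁰⁾) ∨ y⁽¹⁾ ∨ ⋯ ∨ y⁽ˡ⁾,
    -- x = node a b cs, y = node d e fs
    dot : Tree → Tree → List Tree → Tree → Tree → List Tree → 𝒜
    dot a b cs d e fs = mapLC (λ { (h , t) → node a h (t ++ (e ∷ fs)) }) (lastStar b cs d)

    -- x ≻ y = (x * y⁽⁰⁾) ∨ y⁽¹⁾ ∨ ⋯ ∨ y⁽ˡ⁾,  y = node d e fs
    succ : Tree → Tree → Tree → List Tree → 𝒜
    succ x d e fs = mapLC (λ t → node t e fs) (star x d)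

  data Op : Set where
    ≺ · ≻ : Op

  -- the operations on basis trees of 𝒜⁺ ( | ⋉ y and x ⋉ | never arise
  -- for x , y ∈ 𝒜⁺ ; they are set to 0, which is irrelevant below since
  -- those coefficients vanish)
  opT : Op → Tree → Tree → 𝒜
  opT ≺ (node a b cs) y@(node _ _ _) = prec a b cs y
  opT · (node a b cs) (node d e fs) = dot a b cs d e fs
  opT ≻ x@(node _ _ _) (node d e fs) = succ x d e fs
  opT _ _ _ = []

  op : Op → 𝒜 → 𝒜 → 𝒜
  op o u v = concatMap (λ { (k , s) → concatMap (λ { (k′ , t) → (k * k′) ⊙ opT o s t }) v }) u

  data InI : 𝒜 → Set (c ⊔ ℓ) where
    gen   : ∀ {x y} → In𝒜⁺ x → In𝒜⁺ y → InI (op · x y)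
    nil   : InI []
    add   : ∀ {u v} → InI u → InI v → InI (u ++ v)
    scale : ∀ k {u} → InI u → InI (k ⊙ u)
    resp  : ∀ {u v} → u ≈𝒜 v → InI u → InI v
    left  : ∀ o {x y} → InI x → In𝒜⁺ y → InI (op o x y)
    right : ∀ o {x y} → In𝒜⁺ x → InI y → InI (op o x y)

-- If one argument of ≺, · or ≻ is a non-binary tree, every tree in the result is non-binary, and
-- x · y never contains a binary tree: the vertex carrying x⁽ᵏ⁾ * y⁽⁰⁾ keeps x⁽⁰⁾ and y⁽¹⁾ as siblings.
-- So the coefficient of any binary tree vanishes on the generators of I, and stays zero under sums,
-- scalars and products with 𝒜⁺, whence no binary tree lies in I.  Conversely, a vertex with at least
-- three children is (a ∨ b) · (| ∨ d ∨ ⋯) = a ∨ b ∨ d ∨ ⋯, and a non-binary child propagates upwards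
-- through a ≻ (| ∨ b) = a ∨ b and (a ∨ |) ≺ b = a ∨ b, so every non-binary tree lies in I.
module Submission where

open import Defs
open import Level using (Level)
open import Data.Bool using (T; true; false; if_then_else_)
open import Data.Bool.Properties using (T-∧)
open import Data.List using (List; []; _∷_; _++_; concatMap; length)
open import Data.List.Relation.Unary.All as All using (All; []; _∷_)
open import Data.List.Relation.Unary.All.Properties using (map⁺; ++⁺)
open import Data.Nat using (suc; _≤_; z≤n; s≤s)
open import Data.Nat.Properties using (≤-refl; ≤-trans; m≤n⇒m≤1+n)
open import Data.Product using (_×_; _,_; proj₂)
open import Data.Sum as Sum using (_⊎_; inj₁; inj₂)
open import Data.Empty using (⊥-elim)
open import Function using (_∘_)
open import Function.Bundles using (_⇔_; mk⇔; Equivalence)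
open import Relation.Nullary using (¬_; yes; no)
open import Relation.Nullary.Decidable using (map′; _×-dec_)
open import Relation.Nullary.Reflects using (Reflects; ofʸ; ofⁿ; fromEquivalence)
open import Relation.Unary using (Decidable)
open import Relation.Binary.PropositionalEquality using (_≡_; refl; cong₂; subst)
import Algebra.Properties.CommutativeSemigroup as CommSemigroupProperties

isBinary? : Decidable IsBinary
isBinary? leaf = yes leaf
isBinary? (node a b (_ ∷ _)) = no λ ()
isBinary? (node a b []) =
  map′ (λ (p , q) → node p q) (λ { (node p q) → p , q }) (isBinary? a ×-dec isBinary? b)

mutual
  eqT-refl : ∀ t → T (eqT t t)
  eqT-refl leaf = _
  eqT-refl (node a b cs) =
    Equivalence.from T-∧ (eqT-refl a , Equivalence.from T-∧ (eqT-refl b , eqL-refl cs))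

  eqL-refl : ∀ ts → T (eqL ts ts)
  eqL-refl [] = _
  eqL-refl (t ∷ ts) = Equivalence.from T-∧ (eqT-refl t , eqL-refl ts)

node-cong : ∀ {a a′ b b′ cs cs′} → a ≡ a′ → b ≡ b′ → cs ≡ cs′ → node a b cs ≡ node a′ b′ cs′
node-cong refl refl refl = refl

mutual
  eqT⇒≡ : ∀ s t → T (eqT s t) → s ≡ t
  eqT⇒≡ leaf leaf _ = refl
  eqT⇒≡ (node a b cs) (node a′ b′ cs′) p =
    let pa , pbcs = Equivalence.to T-∧ p
        pb , pcs = Equivalence.to T-∧ pbcs
    in node-cong (eqT⇒≡ a a′ pa) (eqT⇒≡ b b′ pb) (eqL⇒≡ cs cs′ pcs)

  eqL⇒≡ : ∀ ss ts → T (eqL ss ts) → ss ≡ ts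
  eqL⇒≡ [] [] _ = refl
  eqL⇒≡ (s ∷ ss) (t ∷ ts) p =
    let ps , pss = Equivalence.to T-∧ p
    in cong₂ _∷_ (eqT⇒≡ s t ps) (eqL⇒≡ ss ts pss)

eqT-reflects : ∀ s t → Reflects (s ≡ t) (eqT s t)
eqT-reflects s t = fromEquivalence (eqT⇒≡ s t) λ { refl → eqT-refl s }

module _ {c ℓ} (F : Field c ℓ) where
  open Field F renaming (refl to ≈-refl)
  open TriDend F
  open CommSemigroupProperties +-commutativeSemigroup using () renaming (x∙yz≈y∙xz to x+[y+z]≈y+[x+z])
  open CommSemigroupProperties *-commutativeSemigroup using () renaming (x∙yz≈y∙xz to x*[y*z]≈y*[x*z])

  AllNonBinary : 𝒜 → Set c
  AllNonBinary = All (¬_ ∘ IsBinary ∘ proj₂)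

  All-mapLC : {A B : Set} {P : A → Set} {Q : B → Set} (f : A → B) → (∀ {a} → P a → Q (f a)) →
              {v : LC A} → All (P ∘ proj₂) v → All (Q ∘ proj₂) (mapLC f v)
  All-mapLC f h = map⁺ ∘ All.map h

  All-mapLC-universal : {A B : Set} {Q : B → Set} (f : A → B) → (∀ a → Q (f a)) →
                        (v : LC A) → All (Q ∘ proj₂) (mapLC f v)
  All-mapLC-universal f h v = map⁺ (All.universal (h ∘ proj₂) v)

  ForcesNonBinary : Tree × List Tree → Set
  ForcesNonBinary (h , ts) = ∀ a → ¬ IsBinary (node a h ts)

  nonBinary-children : ∀ {a b} → ¬ IsBinary (node a b []) → ¬ IsBinary a ⊎ ¬ IsBinary b
  nonBinary-children {a} nb with isBinary? a
  ... | yes p = inj₂ λ q → nb (node p q)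
  ... | no ¬p = inj₁ ¬p

  nonBinary-node-++∷ : ∀ a h ts e fs → ¬ IsBinary (node a h (ts ++ e ∷ fs))
  nonBinary-node-++∷ a h [] e fs ()
  nonBinary-node-++∷ a h (_ ∷ _) e fs ()

  lastStar-forces : ∀ b d ds y → All (ForcesNonBinary ∘ proj₂) (lastStar b (d ∷ ds) y)
  lastStar-forces b d ds y = All-mapLC-universal _ (λ _ _ ()) (lastStar d ds y)

  dot-nonBinary : ∀ a b cs d e fs → AllNonBinary (dot a b cs d e fs)
  dot-nonBinary a b cs d e fs = All-mapLC-universal _ (λ (h , ts) → nonBinary-node-++∷ a h ts e fs) _

  mutual
    star-nonBinary : ∀ x y → ¬ IsBinary x ⊎ ¬ IsBinary y → AllNonBinary (star x y)
    star-nonBinary leaf y (inj₁ ¬x) = ⊥-elim (¬x leaf)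
    star-nonBinary leaf y (inj₂ ¬y) = ¬y ∷ []
    star-nonBinary (node a b cs) leaf (inj₁ ¬x) = ¬x ∷ []
    star-nonBinary (node a b cs) leaf (inj₂ ¬y) = ⊥-elim (¬y leaf)
    star-nonBinary (node a b cs) (node d e fs) h =
      ++⁺ (prec-nonBinary a b cs (node d e fs) h)
          (++⁺ (dot-nonBinary a b cs d e fs) (succ-nonBinary (node a b cs) d e fs h))

    lastStar-[]-forces : ∀ b y → ¬ IsBinary b ⊎ ¬ IsBinary y →
                         All (ForcesNonBinary ∘ proj₂) (lastStar b [] y)
    lastStar-[]-forces b y h = All-mapLC _ (λ ¬t _ → λ { (node _ p) → ¬t p }) (star-nonBinary b y h)

    prec-nonBinary : ∀ a b cs y → ¬ IsBinary (node a b cs) ⊎ ¬ IsBinary y → AllNonBinary (prec a b cs y)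
    prec-nonBinary a b (d ∷ ds) y _ = All-mapLC _ (λ forces → forces a) (lastStar-forces b d ds y)
    prec-nonBinary a b [] y (inj₂ ¬y) =
      All-mapLC _ (λ forces → forces a) (lastStar-[]-forces b y (inj₂ ¬y))
    prec-nonBinary a b [] y (inj₁ ¬x) with nonBinary-children ¬x
    ... | inj₁ ¬a = All-mapLC-universal _ (λ _ → λ { (node p _) → ¬a p }) (lastStar b [] y)
    ... | inj₂ ¬b = All-mapLC _ (λ forces → forces a) (lastStar-[]-forces b y (inj₁ ¬b))

    succ-nonBinary : ∀ x d e fs → ¬ IsBinary x ⊎ ¬ IsBinary (node d e fs) → AllNonBinary (succ x d e fs)
    succ-nonBinary x d e (_ ∷ _) _ = All-mapLC-universal _ (λ _ ()) (star x d)
    succ-nonBinary x d e [] (inj₁ ¬x) =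
      All-mapLC _ (λ ¬t → λ { (node p _) → ¬t p }) (star-nonBinary x d (inj₁ ¬x))
    succ-nonBinary x d e [] (inj₂ ¬y) with nonBinary-children ¬y
    ... | inj₁ ¬d = All-mapLC _ (λ ¬t → λ { (node p _) → ¬t p }) (star-nonBinary x d (inj₂ ¬d))
    ... | inj₂ ¬e = All-mapLC-universal _ (λ _ → λ { (node _ q) → ¬e q }) (star x d)

  opT-nonBinary : ∀ o s t → ¬ IsBinary s ⊎ ¬ IsBinary t → AllNonBinary (opT o s t)
  opT-nonBinary ≺ (node a b cs) y@(node _ _ _) h = prec-nonBinary a b cs y h
  opT-nonBinary · (node a b cs) (node d e fs) _ = dot-nonBinary a b cs d e fs
  opT-nonBinary ≻ x@(node _ _ _) (node d e fs) h = succ-nonBinary x d e fs h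
  opT-nonBinary ≺ leaf _ _ = []
  opT-nonBinary ≺ (node _ _ _) leaf _ = []
  opT-nonBinary · leaf _ _ = []
  opT-nonBinary · (node _ _ _) leaf _ = []
  opT-nonBinary ≻ leaf _ _ = []
  opT-nonBinary ≻ (node _ _ _) leaf _ = []

  opT·-nonBinary : ∀ s t → AllNonBinary (opT · s t)
  opT·-nonBinary (node a b cs) (node d e fs) = dot-nonBinary a b cs d e fs
  opT·-nonBinary leaf _ = []
  opT·-nonBinary (node _ _ _) leaf = []

  coeff-++ : ∀ u v r → coeff (u ++ v) r ≈ coeff u r + coeff v r
  coeff-++ [] v r = sym (+-identityˡ _)
  coeff-++ ((k , t) ∷ u) v r = trans (+-congˡ (coeff-++ u v r)) (sym (+-assoc _ _ _))

  coeff-⊙ : ∀ k u r → coeff (k ⊙ u) r ≈ k * coeff u r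
  coeff-⊙ k [] r = sym (zeroʳ k)
  coeff-⊙ k ((k′ , t) ∷ u) r =
    trans (+-cong (if-* (eqT t r)) (coeff-⊙ k u r)) (sym (distribˡ k _ _))
    where
    if-* : ∀ b → (if b then k * k′ else 0#) ≈ k * (if b then k′ else 0#)
    if-* true = ≈-refl
    if-* false = sym (zeroʳ k)

  pairing : (Tree → Carrier) → 𝒜 → Carrier
  pairing f [] = 0#
  pairing f ((k , s) ∷ u) = k * f s + pairing f u

  pairing-basis : ∀ f s → pairing f (basis s) ≈ f s
  pairing-basis f s = trans (+-identityʳ _) (*-identityˡ _)

  pairing-*ˡ : ∀ k f u → pairing (λ t → k * f t) u ≈ k * pairing f u
  pairing-*ˡ k f [] = sym (zeroʳ k)
  pairing-*ˡ k f ((k′ , s) ∷ u) =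
    trans (+-cong (x*[y*z]≈y*[x*z] k′ k (f s)) (pairing-*ˡ k f u)) (sym (distribˡ k _ _))

  coeff-concatMap : ∀ r (g : Carrier × Tree → 𝒜) (f : Tree → Carrier) →
                    (∀ k s → coeff (g (k , s)) r ≈ k * f s) →
                    ∀ u → coeff (concatMap g u) r ≈ pairing f u
  coeff-concatMap r g f h [] = ≈-refl
  coeff-concatMap r g f h ((k , s) ∷ u) =
    trans (coeff-++ (g (k , s)) (concatMap g u) r) (+-cong (h k s) (coeff-concatMap r g f h u))

  coeff-op : ∀ o x y r →
             coeff (op o x y) r ≈ pairing (λ s → pairing (λ t → coeff (opT o s t) r) y) x
  coeff-op o x y r = coeff-concatMap r _ _ outer x
    where
    outer : ∀ k s → _ ≈ k * pairing (λ t → coeff (opT o s t) r) y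
    outer k s = trans (coeff-concatMap r _ (λ t → k * coeff (opT o s t) r) inner y) (pairing-*ˡ k _ y)
      where
      inner : ∀ k′ t → coeff ((k * k′) ⊙ opT o s t) r ≈ k′ * (k * coeff (opT o s t) r)
      inner k′ t =
        trans (coeff-⊙ (k * k′) (opT o s t) r) (trans (*-congʳ (*-comm k k′)) (*-assoc k′ k _))

  op-basis : ∀ o s t → op o (basis s) (basis t) ≈𝒜 opT o s t
  op-basis o s t r =
    trans (coeff-op o (basis s) (basis t) r)
          (trans (pairing-basis (λ s′ → pairing (coeffOp s′) (basis t)) s) (pairing-basis (coeffOp s) t))
    where
    coeffOp : Tree → Tree → Carrier
    coeffOp s′ t′ = coeff (opT o s′ t′) r

  remove : Tree → 𝒜 → 𝒜
  remove s [] = []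
  remove s ((k , t) ∷ u) = if eqT t s then remove s u else (k , t) ∷ remove s u

  length-remove : ∀ s u → length (remove s u) ≤ length u
  length-remove s [] = z≤n
  length-remove s ((k , t) ∷ u) with eqT t s
  ... | true = m≤n⇒m≤1+n (length-remove s u)
  ... | false = s≤s (length-remove s u)

  length-remove-head : ∀ k s u → length (remove s ((k , s) ∷ u)) ≤ length u
  length-remove-head k s u with eqT s s | eqT-reflects s s
  ... | true | _ = length-remove s u
  ... | false | ofⁿ s≢s = ⊥-elim (s≢s refl)

  coeff-∷-other : ∀ k t u s → ¬ t ≡ s → coeff ((k , t) ∷ u) s ≈ coeff u s
  coeff-∷-other k t u s t≢s with eqT t s | eqT-reflects t s
  ... | true | ofʸ t≡s = ⊥-elim (t≢s t≡s)
  ... | false | _ = +-identityˡ _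

  coeff-remove-self : ∀ s u → coeff (remove s u) s ≈ 0#
  coeff-remove-self s [] = ≈-refl
  coeff-remove-self s ((k , t) ∷ u) with eqT t s | eqT-reflects t s
  ... | true | _ = coeff-remove-self s u
  ... | false | ofⁿ t≢s = trans (coeff-∷-other k t (remove s u) s t≢s) (coeff-remove-self s u)

  coeff-remove-other : ∀ s u t → ¬ s ≡ t → coeff (remove s u) t ≈ coeff u t
  coeff-remove-other s [] t _ = ≈-refl
  coeff-remove-other s ((k , t′) ∷ u) t s≢t with eqT t′ s | eqT-reflects t′ s
  ... | false | _ = +-congˡ (coeff-remove-other s u t s≢t)
  ... | true | ofʸ refl = trans (coeff-remove-other s u t s≢t) (sym (coeff-∷-other k s u t s≢t))

  pairing-remove : ∀ f s u → pairing f u ≈ coeff u s * f s + pairing f (remove s u)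
  pairing-remove f s [] = sym (trans (+-identityʳ _) (zeroˡ _))
  pairing-remove f s ((k , t) ∷ u) with eqT t s | eqT-reflects t s
  ... | true | ofʸ refl =
    trans (+-congˡ (pairing-remove f t u))
          (trans (sym (+-assoc _ _ _)) (+-congʳ (sym (distribʳ (f t) k _))))
  ... | false | _ =
    trans (+-congˡ (pairing-remove f s u))
          (trans (x+[y+z]≈y+[x+z] _ _ _) (+-congʳ (*-congʳ (sym (+-identityˡ _)))))

  -- Entries of u may repeat a tree and cancel each other, so the induction removes one tree at a time.
  pairing-vanishes : ∀ f u → (∀ t → coeff u t ≈ 0# ⊎ f t ≈ 0#) → pairing f u ≈ 0#
  pairing-vanishes f u = go (length u) u ≤-refl
    where
    go : ∀ n u → length u ≤ n → (∀ t → coeff u t ≈ 0# ⊎ f t ≈ 0#) → pairing f u ≈ 0#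
    go _ [] _ _ = ≈-refl
    go (suc n) u@((k , s) ∷ u′) (s≤s len) h =
      trans (pairing-remove f s u) (trans (+-cong head (go n (remove s u) len′ h′)) (+-identityʳ 0#))
      where
      head : coeff u s * f s ≈ 0#
      head with h s
      ... | inj₁ z = trans (*-congʳ z) (zeroˡ _)
      ... | inj₂ z = trans (*-congˡ z) (zeroʳ _)
      len′ : length (remove s u) ≤ n
      len′ = ≤-trans (length-remove-head k s u′) len
      h′ : ∀ t → coeff (remove s u) t ≈ 0# ⊎ f t ≈ 0#
      h′ t with eqT s t | eqT-reflects s t
      ... | true | ofʸ refl = inj₁ (coeff-remove-self s u)
      ... | false | ofⁿ s≢t = Sum.map₁ (trans (coeff-remove-other s u t s≢t)) (h t)

  coeff-op-vanishes : ∀ o x y r →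
    (∀ s → coeff x s ≈ 0# ⊎ (∀ t → coeff y t ≈ 0# ⊎ coeff (opT o s t) r ≈ 0#)) →
    coeff (op o x y) r ≈ 0#
  coeff-op-vanishes o x y r h = trans (coeff-op o x y r) (pairing-vanishes _ x (Sum.map₂ inner ∘ h))
    where
    inner : ∀ {s} → (∀ t → coeff y t ≈ 0# ⊎ coeff (opT o s t) r ≈ 0#) →
            pairing (λ t → coeff (opT o s t) r) y ≈ 0#
    inner = pairing-vanishes _ y

  coeff-nonBinary : ∀ {v r} → AllNonBinary v → IsBinary r → coeff v r ≈ 0#
  coeff-nonBinary [] _ = ≈-refl
  coeff-nonBinary {(k , t) ∷ v} {r} (¬t ∷ ¬v) br =
    trans (coeff-∷-other k t v r λ { refl → ¬t br }) (coeff-nonBinary ¬v br)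

  VanishesOnBinary : 𝒜 → Set ℓ
  VanishesOnBinary u = ∀ r → IsBinary r → coeff u r ≈ 0#

  InI⇒vanishesOnBinary : ∀ {u} → InI u → VanishesOnBinary u
  InI⇒vanishesOnBinary (gen {x} {y} _ _) r br =
    coeff-op-vanishes · x y r λ s → inj₂ λ t → inj₂ (coeff-nonBinary (opT·-nonBinary s t) br)
  InI⇒vanishesOnBinary nil r br = ≈-refl
  InI⇒vanishesOnBinary (add {u} {v} p q) r br =
    trans (coeff-++ u v r)
          (trans (+-cong (InI⇒vanishesOnBinary p r br) (InI⇒vanishesOnBinary q r br)) (+-identityʳ 0#))
  InI⇒vanishesOnBinary (scale k {u} p) r br =
    trans (coeff-⊙ k u r) (trans (*-congˡ (InI⇒vanishesOnBinary p r br)) (zeroʳ k))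
  InI⇒vanishesOnBinary (resp u≈v p) r br = trans (sym (u≈v r)) (InI⇒vanishesOnBinary p r br)
  InI⇒vanishesOnBinary (left o {x} {y} p _) r br = coeff-op-vanishes o x y r h
    where
    h : ∀ s → coeff x s ≈ 0# ⊎ (∀ t → coeff y t ≈ 0# ⊎ coeff (opT o s t) r ≈ 0#)
    h s with isBinary? s
    ... | yes bs = inj₁ (InI⇒vanishesOnBinary p s bs)
    ... | no ¬s = inj₂ λ t → inj₂ (coeff-nonBinary (opT-nonBinary o s t (inj₁ ¬s)) br)
  InI⇒vanishesOnBinary (right o {x} {y} _ p) r br = coeff-op-vanishes o x y r λ s → inj₂ (h s)
    where
    h : ∀ s t → coeff y t ≈ 0# ⊎ coeff (opT o s t) r ≈ 0#
    h s t with isBinary? t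
    ... | yes bt = inj₁ (InI⇒vanishesOnBinary p t bt)
    ... | no ¬t = inj₂ (coeff-nonBinary (opT-nonBinary o s t (inj₂ ¬t)) br)

  InI-basis⇒nonBinary : ∀ t → InI (basis t) → ¬ IsBinary t
  InI-basis⇒nonBinary t p bt = 0≉1 (trans (sym (InI⇒vanishesOnBinary p t bt)) (coeff-basis t))
    where
    coeff-basis : ∀ t → coeff (basis t) t ≈ 1#
    coeff-basis t with eqT t t | eqT-reflects t t
    ... | true | _ = +-identityʳ 1#
    ... | false | ofⁿ t≢t = ⊥-elim (t≢t refl)

  basis-node∈𝒜⁺ : ∀ a b cs → In𝒜⁺ (basis (node a b cs))
  basis-node∈𝒜⁺ a b cs = +-identityʳ 0#

  InI-basis-op : ∀ o s t {u} → opT o s t ≡ basis u → InI (op o (basis s) (basis t)) → InI (basis u)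
  InI-basis-op o s t eq = resp (subst (op o (basis s) (basis t) ≈𝒜_) eq (op-basis o s t))

  dot-graft : ∀ a b d ds → opT · (node a b []) (node leaf d ds) ≡ basis (node a b (d ∷ ds))
  dot-graft a leaf d ds = refl
  dot-graft a (node _ _ _) d ds = refl

  InI-graftˡ : ∀ a b → ¬ IsBinary a → InI (basis a) → InI (basis (node a b []))
  InI-graftˡ leaf b ¬a _ = ⊥-elim (¬a leaf)
  InI-graftˡ a@(node _ _ _) b _ p =
    InI-basis-op ≻ a (node leaf b []) refl (left ≻ {y = basis (node leaf b [])} p (basis-node∈𝒜⁺ leaf b []))

  InI-graftʳ : ∀ a b → ¬ IsBinary b → InI (basis b) → InI (basis (node a b []))
  InI-graftʳ a leaf ¬b _ = ⊥-elim (¬b leaf)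
  InI-graftʳ a b@(node _ _ _) _ p =
    InI-basis-op ≺ (node a leaf []) b refl (right ≺ {x = basis (node a leaf [])} (basis-node∈𝒜⁺ a leaf []) p)

  nonBinary⇒InI-basis : ∀ t → ¬ IsBinary t → InI (basis t)
  nonBinary⇒InI-basis leaf ¬t = ⊥-elim (¬t leaf)
  nonBinary⇒InI-basis (node a b (d ∷ ds)) _ =
    InI-basis-op · (node a b []) (node leaf d ds) (dot-graft a b d ds)
      (gen {basis (node a b [])} {basis (node leaf d ds)} (basis-node∈𝒜⁺ a b []) (basis-node∈𝒜⁺ leaf d ds))
  nonBinary⇒InI-basis (node a b []) ¬t with nonBinary-children ¬t
  ... | inj₁ ¬a = InI-graftˡ a b ¬a (nonBinary⇒InI-basis a ¬a)
  ... | inj₂ ¬b = InI-graftʳ a b ¬b (nonBinary⇒InI-basis b ¬b)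

mainTheorem19 : ∀ {c ℓ : Level} (F : Field c ℓ) (t : Tree) →
    (¬ IsBinary t) ⇔ TriDend.InI F (TriDend.basis F t)
mainTheorem19 F t = mk⇔ (nonBinary⇒InI-basis F t) (InI-basis⇒nonBinary F t)
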